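{- (Subject Reduction.) If $\Gamma\vdash P$ and $P\to P'$, then $\Gamma\vdash P'$.
   Context: The calculus AW$\pi$. Besides success names, each name is an I-name (only input subject) or an O-name (only output subject). Values $v::=a\mid\star$. Processes: $P ::= 0 \mid P \mid Q \mid a(x).P \mid \overline{b}\langle v\rangle \mid (\nu\, a \leftrightarrow b : T)P \mid\ !a(x).P$; input and restriction bind; in $(\nu\,a\leftrightarrow b)P$, $a$ is an I-name and $b$ an O-name. Success names are O-names carrying only $\star$, never restricted. Types $T::=o\,T\mid i\,T\mid\mathsf{unit}$, dual of $o\,T$ is $i\,T$ and vice versa. A type environment is a finite set of bindings $a:T$; $I(\Gamma)$ is the set of names with input type in $\Gamma$; $\Gamma_1,\Gamma_2$ is the union, defined only if they agree on shared names. Typing rules: $\Gamma\vdash 0$; if $\Gamma_1\vdash P_1$, $\Gamma_2\vdash P_2$, $I(\Gamma_1)\cap I(\Gamma_2)=\emptyset$ then $\Gamma_1,\Gamma_2\vdash P_1\mid P_2$; if $\Gamma,a:i\,T,b:o\,T\vdash P$ then $\Gamma\vdash(\nu\,a\leftrightarrow b:i\,T)P$; $\Gamma,a:o\,T,b:T\vdash \overline{a}\langle b\rangle$; if $\Gamma,a:i\,T,b:T\vdash P$ then $\Gamma,a:i\,T\vdash a(b).P$; if $\Gamma_o,b:T\vdash P$ where $\Gamma_o$ assigns only output types, then $\Gamma_o,a:i\,T,\Gamma'\vdash\ !a(b).P$. Structural congruence $\equiv$ is the least congruence with: $P\mid0\equiv P$, $P\mid Q\equiv Q\mid P$, $P\mid(Q\mid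 R)\equiv(P\mid Q)\mid R$, $P\mid(\nu\,a\leftrightarrow b)Q\equiv(\nu\,a\leftrightarrow b)(P\mid Q)$ if $a,b\notin\mathrm{fn}(P)$, $(\nu\,a\leftrightarrow b)(\nu\,c\leftrightarrow d)P\equiv(\nu\,c\leftrightarrow d)(\nu\,a\leftrightarrow b)P$, $(\nu\,a\leftrightarrow b)0\equiv0$. Reduction $\to$ is the least relation such that $(\nu\,a\leftrightarrow b)(a(x).P\mid\overline{b}\langle v\rangle\mid Q)\to(\nu\,a\leftrightarrow b)(P\{v/x\}\mid Q)$, $(\nu\,a\leftrightarrow b)(!a(x).P\mid\overline{b}\langle v\rangle\mid Q)\to(\nu\,a\leftrightarrow b)(!a(x).P\mid P\{v/x\}\mid Q)$, if $P\to P'$ then $P\mid Q\to P'\mid Q$ and $(\nu\,a\leftrightarrow b)P\to(\nu\,a\leftrightarrow b)P'$, and if $P\equiv P'\to P''\equiv P'''$ then $P\to P'''$. -}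

module Defs where

open import Data.Nat using (ℕ; zero; suc)
open import Data.Fin using (Fin; zero; suc)
open import Data.Maybe using (Maybe; just; nothing)
open import Data.Product using (∃; _×_)
open import Data.Empty using (⊥)
open import Relation.Binary.PropositionalEquality using (_≡_)

data Ty : Set where
  o    : Ty → Ty
  i    : Ty → Ty
  unit : Ty

-- Syntax (well-scoped de Bruijn: Proc n has the free names Fin n)
--
-- Values v ::= a | ⋆.  Subjects of prefixes are written as values so
-- that substitution P{v/x} is total; a process with ⋆ in subject
-- position is simply untypable.
--
-- (ν T) P  stands for  (ν a ↔ b : i T) P ; inside P the name a is
-- var zero (the I-name) and b is var (suc zero) (the O-name).
-- inp v P  stands for  v(x).P  with x = var zero inside P;
-- rep v P  stands for  !v(x).P ; out b v stands for  b̄⟨v⟩ .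

data Val (n : ℕ) : Set where
  var : Fin n → Val n
  ⋆   : Val n

infixr 5 _∣_

data Proc (n : ℕ) : Set where
  𝟘   : Proc n
  _∣_ : Proc n → Proc n → Proc n
  inp : Val n → Proc (suc n) → Proc n
  out : Val n → Val n → Proc n
  ν   : Ty → Proc (suc (suc n)) → Proc n
  rep : Val n → Proc (suc n) → Proc n

Sub : ℕ → ℕ → Set
Sub m k = Fin m → Val k

renV : ∀ {m k} → (Fin m → Fin k) → Val m → Val k
renV ρ (var x) = var (ρ x)
renV ρ ⋆       = ⋆

lift : ∀ {m k} → Sub m k → Sub (suc m) (suc k)
lift σ zero    = var zero
lift σ (suc x) = renV suc (σ x)

substV : ∀ {m k} → Sub m k → Val m → Val k
substV σ (var x) = σ x
substV σ ⋆       = ⋆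

subst : ∀ {m k} → Sub m k → Proc m → Proc k
subst σ 𝟘         = 𝟘
subst σ (P ∣ Q)   = subst σ P ∣ subst σ Q
subst σ (inp a P) = inp (substV σ a) (subst (lift σ) P)
subst σ (out b v) = out (substV σ b) (substV σ v)
subst σ (ν T P)   = ν T (subst (lift (lift σ)) P)
subst σ (rep a P) = rep (substV σ a) (subst (lift σ) P)

sub0 : ∀ {n} → Val n → Sub (suc n) n
sub0 v zero    = v
sub0 v (suc x) = var x

_[_] : ∀ {n} → Proc (suc n) → Val n → Proc n
P [ v ] = subst (sub0 v) P

wk2 : ∀ {n} → Proc n → Proc (suc (suc n))
wk2 = subst (λ x → var (suc (suc x)))

-- exchange of two adjacent restrictions:
-- in (ν a↔b)(ν c↔d)P the names are c=0, d=1, a=2, b=3;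
-- in (ν c↔d)(ν a↔b)P' they are a=0, b=1, c=2, d=3.
swapσ : ∀ {n} → Sub (suc (suc (suc (suc n)))) (suc (suc (suc (suc n))))
swapσ zero                      = var (suc (suc zero))
swapσ (suc zero)                = var (suc (suc (suc zero)))
swapσ (suc (suc zero))          = var zero
swapσ (suc (suc (suc zero)))    = var (suc zero)
swapσ (suc (suc (suc (suc x)))) = var (suc (suc (suc (suc x))))

infix 4 _≡ₛ_

data _≡ₛ_ {n : ℕ} : Proc n → Proc n → Set where
  ≡-refl  : ∀ {P} → P ≡ₛ P
  ≡-sym   : ∀ {P Q} → P ≡ₛ Q → Q ≡ₛ P
  ≡-trans : ∀ {P Q R} → P ≡ₛ Q → Q ≡ₛ R → P ≡ₛ R
  ≡-par   : ∀ {P P' Q Q'} → P ≡ₛ P' → Q ≡ₛ Q' → P ∣ Q ≡ₛ P' ∣ Q'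
  ≡-inp   : ∀ {a P P'} → P ≡ₛ P' → inp a P ≡ₛ inp a P'
  ≡-ν     : ∀ {T P P'} → P ≡ₛ P' → ν T P ≡ₛ ν T P'
  ≡-rep   : ∀ {a P P'} → P ≡ₛ P' → rep a P ≡ₛ rep a P'
  par-unit  : ∀ {P} → P ∣ 𝟘 ≡ₛ P
  par-comm  : ∀ {P Q} → P ∣ Q ≡ₛ Q ∣ P
  par-assoc : ∀ {P Q R} → P ∣ (Q ∣ R) ≡ₛ (P ∣ Q) ∣ R
  extrude   : ∀ {P T Q} → P ∣ ν T Q ≡ₛ ν T (wk2 P ∣ Q)
  ν-swap    : ∀ {T U P} → ν T (ν U P) ≡ₛ ν U (ν T (subst swapσ P))
  ν-zero    : ∀ {T} → ν T 𝟘 ≡ₛ 𝟘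

infix 4 _⟶_

a₀ b₀ : ∀ {n} → Val (suc (suc n))
a₀ = var zero
b₀ = var (suc zero)

data _⟶_ {n : ℕ} : Proc n → Proc n → Set where
  r-com : ∀ {T P v Q} →
          ν T (inp a₀ P ∣ out b₀ v ∣ Q) ⟶ ν T (P [ v ] ∣ Q)
  r-rep : ∀ {T P v Q} →
          ν T (rep a₀ P ∣ out b₀ v ∣ Q) ⟶ ν T (rep a₀ P ∣ P [ v ] ∣ Q)
  r-par : ∀ {P P' Q} → P ⟶ P' → P ∣ Q ⟶ P' ∣ Q
  r-ν   : ∀ {T P P'} → P ⟶ P' → ν T P ⟶ ν T P'
  r-≡   : ∀ {P P' P'' P'''} → P ≡ₛ P' → P' ⟶ P'' → P'' ≡ₛ P''' → P ⟶ P'''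

Env : ℕ → Set
Env n = Fin n → Maybe Ty

ext : ∀ {n} → Ty → Env n → Env (suc n)
ext T Γ zero    = just T
ext T Γ (suc x) = Γ x

data Union : Maybe Ty → Maybe Ty → Maybe Ty → Set where
  none  : Union nothing nothing nothing
  left  : ∀ {t} → Union (just t) nothing (just t)
  right : ∀ {t} → Union nothing (just t) (just t)
  both  : ∀ {t} → Union (just t) (just t) (just t)

IsUnion : ∀ {n} → Env n → Env n → Env n → Set
IsUnion Γ₁ Γ₂ Γ = ∀ x → Union (Γ₁ x) (Γ₂ x) (Γ x)

DisjointI : ∀ {n} → Env n → Env n → Set
DisjointI Γ₁ Γ₂ = ∀ x {T U} → Γ₁ x ≡ just (i T) → Γ₂ x ≡ just (i U) → ⊥

OutputOnly : ∀ {n} → Env n → Set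
OutputOnly Γ = ∀ x {T} → Γ x ≡ just T → ∃ λ U → T ≡ o U

_⊆ₑ_ : ∀ {n} → Env n → Env n → Set
Γ₁ ⊆ₑ Γ₂ = ∀ x {T} → Γ₁ x ≡ just T → Γ₂ x ≡ just T

data _⊢ᵥ_∶_ {n : ℕ} (Γ : Env n) : Val n → Ty → Set where
  tv-var  : ∀ {x T} → Γ x ≡ just T → Γ ⊢ᵥ var x ∶ T
  tv-unit : Γ ⊢ᵥ ⋆ ∶ unit

infix 3 _⊢_

data _⊢_ {n : ℕ} : Env n → Proc n → Set where
  t-nil : ∀ {Γ} → Γ ⊢ 𝟘
  t-par : ∀ {Γ Γ₁ Γ₂ P Q} →
          Γ₁ ⊢ P → Γ₂ ⊢ Q → DisjointI Γ₁ Γ₂ → IsUnion Γ₁ Γ₂ Γ →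
          Γ ⊢ P ∣ Q
  t-res : ∀ {Γ T P} →
          ext (i T) (ext (o T) Γ) ⊢ P →
          Γ ⊢ ν T P
  t-out : ∀ {Γ a v T} →
          Γ a ≡ just (o T) → Γ ⊢ᵥ v ∶ T →
          Γ ⊢ out (var a) v
  t-inp : ∀ {Γ a T P} →
          Γ a ≡ just (i T) → ext T Γ ⊢ P →
          Γ ⊢ inp (var a) P
  -- Γₒ,b:T ⊢ P, Γₒ output-only  ⇒  Γₒ,a:iT,Γ' ⊢ !a(b).P
  -- (the conclusion environment Γ is of the form Γₒ,a:iT,Γ' for some Γ'
  --  exactly when Γₒ ⊆ Γ and a:iT ∈ Γ)
  t-rep : ∀ {Γ a T P} (Γₒ : Env n) →
          OutputOnly Γₒ → Γₒ ⊆ₑ Γ → Γ a ≡ just (i T) →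
          ext T Γₒ ⊢ P →
          Γ ⊢ rep (var a) P

-- Typing is invariant under structural congruence, and a communication on a
-- restricted channel a ↔ b : i T replaces the bound input variable x : T of the
-- receiver by the transmitted value v : T.  Everything rests on a substitution
-- lemma whose only delicate point is the side condition I(Γ₁) ∩ I(Γ₂) = ∅ of
-- parallel composition: substitution must not identify two input names coming
-- from different components.  For a communication this holds because if v is
-- an input name, it is owned by the sender, hence by neither the receiver's
-- continuation nor the rest of the process; a replicated receiver's environment
-- has no input names at all.  To carry disjointness through the induction, the
-- substituted process is typed by an environment all of whose bindings are
-- images of bindings of the original one.

module Submission where

open import Defs
open import Data.Nat using (ℕ; suc)
open import Data.Fin using (Fin; zero; suc; _≟_)
open import Data.Maybe using (Maybe; just; nothing; _<∣>_)
open import Data.Maybe.Properties using (just-injective)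
open import Data.Product using (∃; _×_; _,_; proj₁; proj₂)
open import Data.Sum using (_⊎_; inj₁; inj₂)
open import Data.Empty using (⊥; ⊥-elim)
open import Function using (_∘_)
open import Function.Definitions using (Injective)
open import Relation.Nullary using (yes; no)
open import Relation.Binary.PropositionalEquality
  using (_≡_; _≢_; _≗_; refl; sym; trans; cong) renaming (subst to transport)

private variable
  k m n : ℕ
  T U t : Ty
  a b c d : Maybe Ty
  x y : Fin n
  Γ Δ Γ₁ Γ₂ G : Env n
  v w : Val n
  P Q R : Proc n

∅ : Env n
∅ _ = nothing

tail : Env (suc n) → Env n
tail Γ x = Γ (suc x)

var-injective : var x ≡ var y → x ≡ y
var-injective refl = refl

input-not-output : OutputOnly Γ → Γ x ≡ just (i T) → ⊥
input-not-output oo e with oo _ e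
... | _ , ()

⊆-reflexive : Γ ≗ Δ → Γ ⊆ₑ Δ
⊆-reflexive eq x e = trans (sym (eq x)) e

⊆-trans : {Θ : Env n} → Γ ⊆ₑ Δ → Δ ⊆ₑ Θ → Γ ⊆ₑ Θ
⊆-trans s s' x e = s' x (s x e)

⊆-ext : Γ ⊆ₑ Δ → ext T Γ ⊆ₑ ext T Δ
⊆-ext s zero    e = e
⊆-ext s (suc x) e = s x e

⊆-tail : {Γ Δ : Env (suc n)} → Γ ⊆ₑ Δ → tail Γ ⊆ₑ tail Δ
⊆-tail s x = s (suc x)

⊆-ext-tail : {Γ : Env (suc n)} {Δ : Env n} → Γ ⊆ₑ ext T Δ → Γ ⊆ₑ ext T (tail Γ)
⊆-ext-tail s zero    e = s zero e
⊆-ext-tail s (suc x) e = e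

⊆-ext-tail₂ : {Γ : Env (suc (suc n))} {Δ : Env n} →
              Γ ⊆ₑ ext T (ext U Δ) → Γ ⊆ₑ ext T (ext U (tail (tail Γ)))
⊆-ext-tail₂ s = ⊆-trans (⊆-ext-tail s) (⊆-ext (⊆-ext-tail (⊆-tail s)))

Union-⊆ˡ : Union a b c → a ≡ just t → c ≡ just t
Union-⊆ˡ left refl = refl
Union-⊆ˡ both refl = refl

Union-⊆ʳ : Union a b c → b ≡ just t → c ≡ just t
Union-⊆ʳ right refl = refl
Union-⊆ʳ both  refl = refl

⊆-unionˡ : IsUnion Γ₁ Γ₂ Γ → Γ₁ ⊆ₑ Γ
⊆-unionˡ u x = Union-⊆ˡ (u x)

⊆-unionʳ : IsUnion Γ₁ Γ₂ Γ → Γ₂ ⊆ₑ Γ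
⊆-unionʳ u x = Union-⊆ʳ (u x)

-- Left-biased, so it is the union Γ₁,Γ₂ only where Γ₁ and Γ₂ agree (∪-isUnion).
infixl 25 _∪_

_∪_ : Env n → Env n → Env n
(Γ₁ ∪ Γ₂) x = Γ₁ x <∣> Γ₂ x

∪-cases : (Γ₁ Γ₂ : Env n) → (Γ₁ ∪ Γ₂) x ≡ just t → Γ₁ x ≡ just t ⊎ Γ₂ x ≡ just t
∪-cases {x = x} Γ₁ Γ₂ e with Γ₁ x
... | just _  = inj₁ e
... | nothing = inj₂ e

∪-least : Γ₁ ⊆ₑ Γ → Γ₂ ⊆ₑ Γ → Γ₁ ∪ Γ₂ ⊆ₑ Γ
∪-least {Γ₁ = Γ₁} {Γ₂ = Γ₂} s₁ s₂ x e with ∪-cases Γ₁ Γ₂ e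
... | inj₁ e₁ = s₁ x e₁
... | inj₂ e₂ = s₂ x e₂

∪-isUnion : Γ₁ ⊆ₑ Γ → Γ₂ ⊆ₑ Γ → IsUnion Γ₁ Γ₂ (Γ₁ ∪ Γ₂)
∪-isUnion {Γ₁ = Γ₁} {Γ₂ = Γ₂} s₁ s₂ x with Γ₁ x | Γ₂ x | s₁ x | s₂ x
... | nothing | nothing | _  | _  = none
... | nothing | just _  | _  | _  = right
... | just _  | nothing | _  | _  = left
... | just _  | just _  | e₁ | e₂ with trans (sym (e₁ refl)) (e₂ refl)
...   | refl = both

∪-⊆ʳ : Γ₁ ⊆ₑ Γ → Γ₂ ⊆ₑ Γ → Γ₂ ⊆ₑ Γ₁ ∪ Γ₂
∪-⊆ʳ s₁ s₂ = ⊆-unionʳ (∪-isUnion s₁ s₂)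

∪-⊆ˡ : Γ₁ ⊆ₑ Γ₁ ∪ Γ₂
∪-⊆ˡ {Γ₁ = Γ₁} x e with Γ₁ x
∪-⊆ˡ x refl | just _ = refl

-- The new bindings go to the left component, except where the right one
-- already binds the name, so that no input name becomes shared.
padˡ : Union a b c → Maybe Ty → Maybe Ty
padˡ none       d = d
padˡ (left {t}) d = just t
padˡ right      d = nothing
padˡ (both {t}) d = just t

padˡ-⊇ : (u : Union a b c) → a ≡ just t → padˡ u d ≡ just t
padˡ-⊇ left refl = refl
padˡ-⊇ both refl = refl

padˡ-union : (u : Union a b c) → (∀ {t} → c ≡ just t → d ≡ just t) → Union (padˡ u d) b d
padˡ-union {d = nothing} none _ = none
padˡ-union {d = just _}  none _ = left
padˡ-union left  s with s refl
... | refl = left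
padˡ-union right s with s refl
... | refl = right
padˡ-union both  s with s refl
... | refl = both

padˡ-input : (u : Union a b c) → padˡ u d ≡ just (i T) → b ≡ just (i U) → a ≡ just (i T)
padˡ-input none  _ ()
padˡ-input left  _ ()
padˡ-input right () _
padˡ-input both  e _ = e

weakenᵥ : Γ ⊆ₑ Δ → Γ ⊢ᵥ v ∶ T → Δ ⊢ᵥ v ∶ T
weakenᵥ s (tv-var e) = tv-var (s _ e)
weakenᵥ s tv-unit    = tv-unit

weaken : Γ ⊆ₑ Δ → Γ ⊢ P → Δ ⊢ P
weaken s t-nil = t-nil
weaken {Δ = Δ} s (t-par d₁ d₂ dis u) =
  t-par {Γ₁ = λ x → padˡ (u x) (Δ x)}
        (weaken (λ x → padˡ-⊇ (u x)) d₁) d₂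
        (λ x e e' → dis x (padˡ-input (u x) e e') e')
        (λ x → padˡ-union (u x) (s x))
weaken s (t-res d)             = t-res (weaken (⊆-ext (⊆-ext s)) d)
weaken s (t-out e dv)          = t-out (s _ e) (weakenᵥ s dv)
weaken s (t-inp e d)           = t-inp (s _ e) (weaken (⊆-ext s) d)
weaken s (t-rep Γₒ oo s' e d) = t-rep Γₒ oo (⊆-trans s' s) (s _ e) d

⊢-par : Γ₁ ⊢ P → Γ₂ ⊢ Q → Γ₁ ⊆ₑ Γ → Γ₂ ⊆ₑ Γ → DisjointI Γ₁ Γ₂ → Γ ⊢ P ∣ Q
⊢-par d₁ d₂ s₁ s₂ dis = weaken (∪-least s₁ s₂) (t-par d₁ d₂ dis (∪-isUnion s₁ s₂))

infix 4 _⇛_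

_⇛_ : Proc n → Proc n → Set
P ⇛ Q = ∀ {Γ} → Γ ⊢ P → Γ ⊢ Q

∣-identityʳ : P ∣ 𝟘 ⇛ P
∣-identityʳ (t-par d _ _ u) = weaken (⊆-unionˡ u) d

∣-identityʳ⁻¹ : P ⇛ P ∣ 𝟘
∣-identityʳ⁻¹ d = ⊢-par {Γ₂ = ∅} d t-nil (λ _ e → e) (λ _ ()) (λ _ _ ())

∣-comm : P ∣ Q ⇛ Q ∣ P
∣-comm (t-par d₁ d₂ dis u) = ⊢-par d₂ d₁ (⊆-unionʳ u) (⊆-unionˡ u) (λ x e e' → dis x e' e)

∣-assoc⁻¹ : P ∣ (Q ∣ R) ⇛ (P ∣ Q) ∣ R
∣-assoc⁻¹ (t-par {Γ₁ = A} dP (t-par {Γ₁ = B₁} dQ dR disQR uQR) dis u) =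
  ⊢-par (t-par dP dQ disPQ (∪-isUnion sA sB₁)) dR
        (∪-least sA sB₁) (⊆-trans (⊆-unionʳ uQR) (⊆-unionʳ u)) disPQ-R
  where
  sA  = ⊆-unionˡ u
  sB₁ = ⊆-trans (⊆-unionˡ uQR) (⊆-unionʳ u)
  disPQ : DisjointI A B₁
  disPQ x e e' = dis x e (⊆-unionˡ uQR x e')
  disPQ-R : DisjointI (A ∪ B₁) _
  disPQ-R x e e' with ∪-cases A B₁ e
  ... | inj₁ eA = dis x eA (⊆-unionʳ uQR x e')
  ... | inj₂ eB = disQR x eB e'

∣-assoc : (P ∣ Q) ∣ R ⇛ P ∣ (Q ∣ R)
∣-assoc = ∣-comm ∘ ∣-assoc⁻¹ ∘ ∣-comm ∘ ∣-assoc⁻¹ ∘ ∣-comm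

-- Renamings are given as substitutions σ ≗ var ∘ ρ because lift (var ∘ ρ) is
-- only pointwise equal to var ∘ liftᵣ ρ.

liftᵣ : (Fin m → Fin k) → Fin (suc m) → Fin (suc k)
liftᵣ ρ zero    = zero
liftᵣ ρ (suc x) = suc (ρ x)

lift-var : {σ : Sub m k} {ρ : Fin m → Fin k} → σ ≗ var ∘ ρ → lift σ ≗ var ∘ liftᵣ ρ
lift-var eq zero    = refl
lift-var eq (suc x) = cong (renV suc) (eq x)

ext-∘-liftᵣ : {Γ : Env k} {ρ : Fin m → Fin k} → (ext T Γ ∘ liftᵣ ρ) ⊆ₑ ext T (Γ ∘ ρ)
ext-∘-liftᵣ zero    e = e
ext-∘-liftᵣ (suc x) e = e

⊢ᵥ-unrename : {σ : Sub m k} {ρ : Fin m → Fin k} {Γ : Env k} (v : Val m) →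
              σ ≗ var ∘ ρ → Γ ⊢ᵥ substV σ v ∶ T → (Γ ∘ ρ) ⊢ᵥ v ∶ T
⊢ᵥ-unrename ⋆ eq tv-unit = tv-unit
⊢ᵥ-unrename {σ = σ} (var x) eq dv with σ x | eq x | dv
... | _ | refl | tv-var e = tv-var e

⊢-unrename : {σ : Sub m k} {ρ : Fin m → Fin k} {Γ : Env k} (P : Proc m) →
             σ ≗ var ∘ ρ → Γ ⊢ subst σ P → Γ ∘ ρ ⊢ P
⊢-unrename 𝟘 eq t-nil = t-nil
⊢-unrename {ρ = ρ} (P ∣ Q) eq (t-par d₁ d₂ dis u) =
  t-par (⊢-unrename P eq d₁) (⊢-unrename Q eq d₂) (λ x → dis (ρ x)) (λ x → u (ρ x))
⊢-unrename (ν T P) eq (t-res d) =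
  t-res (weaken (⊆-trans ext-∘-liftᵣ (⊆-ext ext-∘-liftᵣ)) (⊢-unrename P (lift-var (lift-var eq)) d))
⊢-unrename {σ = σ} (out (var a) v) eq d with σ a | eq a | d
... | _ | refl | t-out e dv = t-out e (⊢ᵥ-unrename v eq dv)
⊢-unrename {σ = σ} (inp (var a) P) eq d with σ a | eq a | d
... | _ | refl | t-inp e d' = t-inp e (weaken ext-∘-liftᵣ (⊢-unrename P (lift-var eq) d'))
⊢-unrename {σ = σ} {ρ = ρ} (rep (var a) P) eq d with σ a | eq a | d
... | _ | refl | t-rep Γₒ oo s e d' =
  t-rep (Γₒ ∘ ρ) (λ x → oo (ρ x)) (λ x → s (ρ x)) e (weaken ext-∘-liftᵣ (⊢-unrename P (lift-var eq) d'))
⊢-unrename (out ⋆ v) eq ()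
⊢-unrename (inp ⋆ P) eq ()
⊢-unrename (rep ⋆ P) eq ()

-- Substitution

_⊢ₛ_∶_ : Env k → Sub m k → Env m → Set
Γ ⊢ₛ σ ∶ Δ = ∀ x {T} → Δ x ≡ just T → Γ ⊢ᵥ σ x ∶ T

InputInjective : Sub m k → Env m → Set
InputInjective σ Δ =
  ∀ x x' {T T' y} → Δ x ≡ just (i T) → Δ x' ≡ just (i T') → σ x ≡ var y → σ x' ≡ var y → x ≡ x'

Covered : Env k → Sub m k → Env m → Set
Covered G σ Δ = ∀ y {U} → G y ≡ just U → ∃ λ x → σ x ≡ var y × Δ x ≡ just U

record ImageTyping (Γ : Env k) (σ : Sub m k) (Δ : Env m) (Q : Proc k) : Set where
  constructor image
  field
    {env}   : Env k
    env-⊆   : env ⊆ₑ Γ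
    covered : Covered env σ Δ
    typing  : env ⊢ Q

⊢ᵥ-shift : Γ ⊢ᵥ w ∶ U → ext T Γ ⊢ᵥ renV suc w ∶ U
⊢ᵥ-shift (tv-var e) = tv-var e
⊢ᵥ-shift tv-unit    = tv-unit

shift≢zero : renV suc w ≡ var zero → ⊥
shift≢zero {w = var _} ()
shift≢zero {w = ⋆}     ()

unshift : renV suc w ≡ var (suc y) → w ≡ var y
unshift {w = var _} refl = refl

infix 30 _↦_

_↦_ : Fin n → Ty → Env n
(z ↦ T) y with y ≟ z
... | yes _ = just T
... | no  _ = nothing

↦-self : (z : Fin n) → (z ↦ T) z ≡ just T
↦-self z with z ≟ z
... | yes _ = refl
... | no z≢z = ⊥-elim (z≢z refl)

↦-⊆ : {z : Fin n} → Γ z ≡ just T → (z ↦ T) ⊆ₑ Γ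
↦-⊆ {z = z} e y e' with y ≟ z | e'
... | yes refl | refl = e

↦-inv : {z : Fin n} → (z ↦ T) y ≡ just U → y ≡ z × T ≡ U
↦-inv {y = y} {z = z} e with y ≟ z | e
... | yes y≡z | refl = y≡z , refl

⟨_∶_⟩ : Val n → Ty → Env n
⟨ var y ∶ T ⟩ = y ↦ T
⟨ ⋆     ∶ T ⟩ = ∅

⟨⟩-⊆ : Γ ⊢ᵥ w ∶ T → ⟨ w ∶ T ⟩ ⊆ₑ Γ
⟨⟩-⊆ (tv-var e) = ↦-⊆ e
⟨⟩-⊆ tv-unit _ ()

⊢ᵥ-⟨⟩ : Γ ⊢ᵥ w ∶ T → ⟨ w ∶ T ⟩ ⊢ᵥ w ∶ T
⊢ᵥ-⟨⟩ (tv-var {x = y} _) = tv-var (↦-self y)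
⊢ᵥ-⟨⟩ tv-unit            = tv-unit

⟨⟩-inv : ⟨ w ∶ T ⟩ y ≡ just U → w ≡ var y × T ≡ U
⟨⟩-inv {w = var _} {T = T} e with ↦-inv {T = T} e
... | refl , T≡U = refl , T≡U

⊢ᵥ-var : Γ ⊢ᵥ w ∶ T → T ≢ unit → ∃ λ y → w ≡ var y × Γ y ≡ just T
⊢ᵥ-var (tv-var e) _    = _ , refl , e
⊢ᵥ-var tv-unit    T≢unit = ⊥-elim (T≢unit refl)

module _ {σ : Sub m k} where

  ⊢ᵥ-subst : Γ ⊢ₛ σ ∶ Δ → Δ ⊢ᵥ v ∶ T → Γ ⊢ᵥ substV σ v ∶ T
  ⊢ᵥ-subst ok (tv-var e) = ok _ e
  ⊢ᵥ-subst ok tv-unit    = tv-unit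

  ⊢ₛ-⊆ : Δ ⊆ₑ Γ₁ → Γ ⊢ₛ σ ∶ Γ₁ → Γ ⊢ₛ σ ∶ Δ
  ⊢ₛ-⊆ s ok x e = ok x (s x e)

  ⊢ₛ-lift : Γ ⊢ₛ σ ∶ Δ → ext T Γ ⊢ₛ lift σ ∶ ext T Δ
  ⊢ₛ-lift ok zero    e = tv-var e
  ⊢ₛ-lift ok (suc x) e = ⊢ᵥ-shift (ok x e)

  injective-⊆ : Δ ⊆ₑ Γ → InputInjective σ Γ → InputInjective σ Δ
  injective-⊆ s inj x x' e e' = inj x x' (s x e) (s x' e')

  injective-lift : InputInjective σ Δ → InputInjective (lift σ) (ext T Δ)
  injective-lift inj zero    zero     _ _ _ _ = refl
  injective-lift inj zero    (suc x') _ _ refl q' = ⊥-elim (shift≢zero q')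
  injective-lift inj (suc x) zero     _ _ q refl = ⊥-elim (shift≢zero q)
  injective-lift inj (suc x) (suc x') {y = zero}  _ _ q _ = ⊥-elim (shift≢zero q)
  injective-lift inj (suc x) (suc x') {y = suc _} e e' q q' =
    cong suc (inj x x' e e' (unshift q) (unshift q'))

  covered-⊆ : Δ ⊆ₑ Γ → Covered G σ Δ → Covered G σ Γ
  covered-⊆ s c y e with c y e
  ... | x , q , e' = x , q , s x e'

  covered-∪ : Covered Γ₁ σ Δ → Covered Γ₂ σ Δ → Covered (Γ₁ ∪ Γ₂) σ Δ
  covered-∪ {Γ₁ = Γ₁} {Γ₂ = Γ₂} c₁ c₂ y e with ∪-cases Γ₁ Γ₂ e
  ... | inj₁ e₁ = c₁ y e₁
  ... | inj₂ e₂ = c₂ y e₂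

  covered-tail : Covered G (lift σ) (ext T Δ) → Covered (tail G) σ Δ
  covered-tail c y e with c (suc y) e
  ... | zero  , () , _
  ... | suc x , q  , e' = x , unshift q , e'

  covered-disjoint : InputInjective σ Δ → Γ₁ ⊆ₑ Δ → Γ₂ ⊆ₑ Δ → DisjointI Γ₁ Γ₂ →
                     {G₁ G₂ : Env k} → Covered G₁ σ Γ₁ → Covered G₂ σ Γ₂ → DisjointI G₁ G₂
  covered-disjoint inj s₁ s₂ dis c₁ c₂ y e₁ e₂ with c₁ y e₁ | c₂ y e₂
  ... | x₁ , q₁ , e₁' | x₂ , q₂ , e₂' with inj x₁ x₂ (s₁ x₁ e₁') (s₂ x₂ e₂') q₁ q₂
  ... | refl = dis x₁ e₁' e₂'

  covered-↦ : {z : Fin m} {z' : Fin k} → σ z ≡ var z' → Δ z ≡ just T → Covered (z' ↦ T) σ Δ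
  covered-↦ {T = T} q e y e' with ↦-inv {T = T} e'
  ... | refl , refl = _ , q , e

  covered-⟨⟩ : Δ ⊢ᵥ v ∶ T → Covered ⟨ substV σ v ∶ T ⟩ σ Δ
  covered-⟨⟩ {T = T} (tv-var e) y e' with ⟨⟩-inv {T = T} e'
  ... | q , refl = _ , q , e
  covered-⟨⟩ tv-unit y ()

  covered-outputOnly : OutputOnly Δ → Covered G σ Δ → OutputOnly G
  covered-outputOnly oo c y e with c y e
  ... | x , _ , e' = oo x e'

module Prefix {σ : Sub m k} {Δ : Env m} {Γ G : Env k} {z : Fin m} {z' : Fin k}
              (q : σ z ≡ var z') (e : Δ z ≡ just t) (e' : Γ z' ≡ just t)
              (s : G ⊆ₑ Γ) (c : Covered G σ Δ) where

  env : Env k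
  env = (z' ↦ t) ∪ G

  env-⊆ : env ⊆ₑ Γ
  env-⊆ = ∪-least (↦-⊆ e') s

  covered : Covered env σ Δ
  covered = covered-∪ (covered-↦ q e) c

  subject : env z' ≡ just t
  subject = ∪-⊆ˡ {Γ₁ = z' ↦ t} {Γ₂ = G} z' (↦-self z')

  body-⊆ : G ⊆ₑ env
  body-⊆ = ∪-⊆ʳ (↦-⊆ e') s

⊢-subst : {σ : Sub m k} → Δ ⊢ P → Γ ⊢ₛ σ ∶ Δ → InputInjective σ Δ → ImageTyping Γ σ Δ (subst σ P)
⊢-subst t-nil ok inj = image {env = ∅} (λ _ ()) (λ _ ()) t-nil
⊢-subst (t-par d₁ d₂ dis u) ok inj
  with ⊢-subst d₁ (⊢ₛ-⊆ (⊆-unionˡ u) ok) (injective-⊆ (⊆-unionˡ u) inj)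
     | ⊢-subst d₂ (⊢ₛ-⊆ (⊆-unionʳ u) ok) (injective-⊆ (⊆-unionʳ u) inj)
... | image s₁ c₁ d₁' | image s₂ c₂ d₂' =
  image (∪-least s₁ s₂) (covered-∪ (covered-⊆ (⊆-unionˡ u) c₁) (covered-⊆ (⊆-unionʳ u) c₂))
        (t-par d₁' d₂' (covered-disjoint inj (⊆-unionˡ u) (⊆-unionʳ u) dis c₁ c₂) (∪-isUnion s₁ s₂))
⊢-subst (t-res d) ok inj with ⊢-subst d (⊢ₛ-lift (⊢ₛ-lift ok)) (injective-lift (injective-lift inj))
... | image s c d' =
  image (⊆-tail (⊆-tail s)) (covered-tail (covered-tail c)) (t-res (weaken (⊆-ext-tail₂ s) d'))
⊢-subst (t-out {a = z} e dv) ok inj with ⊢ᵥ-var (ok z e) (λ ())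
... | z' , q , e' rewrite q = image env-⊆ covered (t-out subject (weakenᵥ body-⊆ (⊢ᵥ-⟨⟩ dw)))
  where
  dw = ⊢ᵥ-subst ok dv
  open Prefix q e e' (⟨⟩-⊆ dw) (covered-⟨⟩ dv)
⊢-subst (t-inp {a = z} e d) ok inj
  with ⊢ᵥ-var (ok z e) (λ ()) | ⊢-subst d (⊢ₛ-lift ok) (injective-lift inj)
... | z' , q , e' | image s c d' rewrite q =
  image env-⊆ covered (t-inp subject (weaken (⊆-trans (⊆-ext-tail s) (⊆-ext body-⊆)) d'))
  where open Prefix q e e' (⊆-tail s) (covered-tail c)
⊢-subst (t-rep {a = z} Γₒ oo sₒ e d) ok inj
  with ⊢ᵥ-var (ok z e) (λ ()) | ⊢-subst d (⊢ₛ-lift (⊢ₛ-⊆ sₒ ok)) (injective-lift (injective-⊆ sₒ inj))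
... | z' , q , e' | image s c d' rewrite q =
  image env-⊆ covered
        (t-rep _ (covered-outputOnly oo (covered-tail c)) body-⊆ subject (weaken (⊆-ext-tail s) d'))
  where open Prefix q e e' (⊆-tail s) (covered-⊆ sₒ (covered-tail c))

⊢ₛ-ren : {σ : Sub m k} {ρ : Fin m → Fin k} → σ ≗ var ∘ ρ → Δ ⊆ₑ (Γ ∘ ρ) → Γ ⊢ₛ σ ∶ Δ
⊢ₛ-ren eq s x e rewrite eq x = tv-var (s x e)

injective-ren : {σ : Sub m k} {ρ : Fin m → Fin k} →
                σ ≗ var ∘ ρ → Injective _≡_ _≡_ ρ → InputInjective σ Δ
injective-ren eq ρ-inj x x' _ _ q q' =
  ρ-inj (var-injective (trans (sym (eq x)) (trans q (trans (sym q') (eq x')))))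

-- Structural congruence

extrude-⊢ : P ∣ ν T Q ⇛ ν T (wk2 P ∣ Q)
extrude-⊢ (t-par dP (t-res dQ) dis u)
  with ⊢-subst dP (⊢ₛ-ren (λ _ → refl) (⊆-unionˡ u)) (injective-ren (λ _ → refl) λ { refl → refl })
... | image s c dP' = t-res (⊢-par dP' dQ s (⊆-ext (⊆-ext (⊆-unionʳ u))) disjoint)
  where
  disjoint : DisjointI _ _
  disjoint y e e' with c y e
  ... | x , refl , e₁ = dis x e₁ e'

extrude⁻¹-⊢ : ν T (wk2 P ∣ Q) ⇛ P ∣ ν T Q
extrude⁻¹-⊢ {P = P} (t-res (t-par dP dQ dis u)) =
  ⊢-par (⊢-unrename P (λ _ → refl) dP) (t-res (weaken (⊆-ext-tail₂ (⊆-unionʳ u)) dQ))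
        (⊆-tail (⊆-tail (⊆-unionˡ u))) (⊆-tail (⊆-tail (⊆-unionʳ u))) (λ x → dis (suc (suc x)))

swapᶠ : Fin (suc (suc (suc (suc n)))) → Fin (suc (suc (suc (suc n))))
swapᶠ zero                      = suc (suc zero)
swapᶠ (suc zero)                = suc (suc (suc zero))
swapᶠ (suc (suc zero))          = zero
swapᶠ (suc (suc (suc zero)))    = suc zero
swapᶠ (suc (suc (suc (suc x)))) = suc (suc (suc (suc x)))

swapσ-var : swapσ {n} ≗ var ∘ swapᶠ
swapσ-var zero                      = refl
swapσ-var (suc zero)                = refl
swapσ-var (suc (suc zero))          = refl
swapσ-var (suc (suc (suc zero)))    = refl
swapσ-var (suc (suc (suc (suc x)))) = refl

swapᶠ-involutive : (x : Fin (suc (suc (suc (suc n))))) → swapᶠ (swapᶠ x) ≡ x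
swapᶠ-involutive zero                      = refl
swapᶠ-involutive (suc zero)                = refl
swapᶠ-involutive (suc (suc zero))          = refl
swapᶠ-involutive (suc (suc (suc zero)))    = refl
swapᶠ-involutive (suc (suc (suc (suc x)))) = refl

swapᶠ-injective : Injective _≡_ _≡_ (swapᶠ {n})
swapᶠ-injective {x = x} {y = x'} eq =
  trans (sym (swapᶠ-involutive x)) (trans (cong swapᶠ eq) (swapᶠ-involutive x'))

ext⁴-swapᶠ : {A B C D : Ty} (x : Fin (suc (suc (suc (suc n))))) →
             ext A (ext B (ext C (ext D Γ))) (swapᶠ x) ≡ ext C (ext D (ext A (ext B Γ))) x
ext⁴-swapᶠ zero                      = refl
ext⁴-swapᶠ (suc zero)                = refl
ext⁴-swapᶠ (suc (suc zero))          = refl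
ext⁴-swapᶠ (suc (suc (suc zero)))    = refl
ext⁴-swapᶠ (suc (suc (suc (suc x)))) = refl

ν-swap-⊢ : {P : Proc (suc (suc (suc (suc n))))} → ν T (ν U P) ⇛ ν U (ν T (subst swapσ P))
ν-swap-⊢ (t-res (t-res d))
  with ⊢-subst d (⊢ₛ-ren swapσ-var (⊆-reflexive (λ x → sym (ext⁴-swapᶠ x))))
                 (injective-ren swapσ-var swapᶠ-injective)
... | image s _ d' = t-res (t-res (weaken s d'))

ν-swap⁻¹-⊢ : {P : Proc (suc (suc (suc (suc n))))} → ν U (ν T (subst swapσ P)) ⇛ ν T (ν U P)
ν-swap⁻¹-⊢ {P = P} (t-res (t-res d)) =
  t-res (t-res (weaken (⊆-reflexive ext⁴-swapᶠ) (⊢-unrename P swapσ-var d)))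

∣-mono : {P P' Q Q' : Proc n} → P ⇛ P' → Q ⇛ Q' → P ∣ Q ⇛ P' ∣ Q'
∣-mono f g (t-par d₁ d₂ dis u) = t-par (f d₁) (g d₂) dis u

ν-mono : {P P' : Proc (suc (suc n))} → P ⇛ P' → ν T P ⇛ ν T P'
ν-mono f (t-res d) = t-res (f d)

inp-mono : {P P' : Proc (suc n)} → P ⇛ P' → inp v P ⇛ inp v P'
inp-mono f (t-inp e d) = t-inp e (f d)

rep-mono : {P P' : Proc (suc n)} → P ⇛ P' → rep v P ⇛ rep v P'
rep-mono f (t-rep Γₒ oo s e d) = t-rep Γₒ oo s e (f d)

⊢-≡ₛ : P ≡ₛ Q → (P ⇛ Q) × (Q ⇛ P)
⊢-≡ₛ ≡-refl          = (λ d → d) , (λ d → d)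
⊢-≡ₛ (≡-sym e)       = proj₂ (⊢-≡ₛ e) , proj₁ (⊢-≡ₛ e)
⊢-≡ₛ (≡-trans e e')  = proj₁ (⊢-≡ₛ e') ∘ proj₁ (⊢-≡ₛ e) , proj₂ (⊢-≡ₛ e) ∘ proj₂ (⊢-≡ₛ e')
⊢-≡ₛ (≡-par e e')    = ∣-mono (proj₁ (⊢-≡ₛ e)) (proj₁ (⊢-≡ₛ e'))
                     , ∣-mono (proj₂ (⊢-≡ₛ e)) (proj₂ (⊢-≡ₛ e'))
⊢-≡ₛ (≡-inp e)       = inp-mono (proj₁ (⊢-≡ₛ e)) , inp-mono (proj₂ (⊢-≡ₛ e))
⊢-≡ₛ (≡-ν e)         = ν-mono (proj₁ (⊢-≡ₛ e)) , ν-mono (proj₂ (⊢-≡ₛ e))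
⊢-≡ₛ (≡-rep e)       = rep-mono (proj₁ (⊢-≡ₛ e)) , rep-mono (proj₂ (⊢-≡ₛ e))
⊢-≡ₛ par-unit        = ∣-identityʳ , ∣-identityʳ⁻¹
⊢-≡ₛ par-comm        = ∣-comm , ∣-comm
⊢-≡ₛ par-assoc       = ∣-assoc⁻¹ , ∣-assoc
⊢-≡ₛ extrude         = extrude-⊢ , extrude⁻¹-⊢
⊢-≡ₛ ν-swap          = ν-swap-⊢ , ν-swap⁻¹-⊢
⊢-≡ₛ ν-zero          = (λ _ → t-nil) , (λ _ → t-res t-nil)

-- Communication

disjoint-sym : DisjointI Γ₁ Γ₂ → DisjointI Γ₂ Γ₁
disjoint-sym dis x e e' = dis x e' e

disjoint-⊆ʳ : Γ₂ ⊆ₑ Γ → DisjointI Γ₁ Γ → DisjointI Γ₁ Γ₂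
disjoint-⊆ʳ s dis x e e' = dis x e (s x e')

disjoint-∪ʳ : DisjointI Γ Γ₁ → DisjointI Γ Γ₂ → DisjointI Γ (Γ₁ ∪ Γ₂)
disjoint-∪ʳ {Γ₁ = Γ₁} {Γ₂ = Γ₂} dis₁ dis₂ x e e' with ∪-cases Γ₁ Γ₂ e'
... | inj₁ e₁ = dis₁ x e e₁
... | inj₂ e₂ = dis₂ x e e₂

outputOnly-disjoint : OutputOnly Γ₁ → DisjointI Γ₁ Γ₂
outputOnly-disjoint oo x e _ = input-not-output oo e

⊢ᵥ-lookup : Γ ⊢ᵥ var x ∶ T → Γ x ≡ just T
⊢ᵥ-lookup (tv-var e) = e

⊢-receive : {Δ C Γ : Env n} {P : Proc (suc n)} → ext T Δ ⊢ P → C ⊢ᵥ v ∶ T →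
            Δ ⊆ₑ Γ → C ⊆ₑ Γ → DisjointI Δ C → ImageTyping Γ (sub0 v) (ext T Δ) (P [ v ])
⊢-receive {T = T} {v = v} {Δ = Δ} {Γ = Γ} d dv sΔ sC dis = ⊢-subst d ok inj
  where
  ok : Γ ⊢ₛ sub0 v ∶ ext T Δ
  ok zero    e = transport (Γ ⊢ᵥ v ∶_) (just-injective e) (weakenᵥ sC dv)
  ok (suc x) e = tv-var (sΔ x e)
  v-fresh : ∀ {y U V} → v ≡ var y → T ≡ i U → Δ y ≡ just (i V) → ⊥
  v-fresh {y} refl refl e = dis y e (⊢ᵥ-lookup dv)
  inj : InputInjective (sub0 v) (ext T Δ)
  inj zero    zero     _ _  _    _    = refl
  inj zero    (suc x') e e' q    refl = ⊥-elim (v-fresh q (just-injective e) e')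
  inj (suc x) zero     e e' refl q'   = ⊥-elim (v-fresh q' (just-injective e') e)
  inj (suc x) (suc x') _ _  refl refl = refl

received-disjoint : {Δ C Θ G : Env n} → Covered G (sub0 v) (ext T Δ) → C ⊢ᵥ v ∶ T →
                    DisjointI Δ Θ → DisjointI C Θ → DisjointI G Θ
received-disjoint c dv disΔ disC y e e' with c y e
... | zero  , refl , e₁ = disC y (trans (⊢ᵥ-lookup dv) e₁) e'
... | suc x , refl , e₁ = disΔ x e₁ e'

restricted-channel-types : {Γ : Env n} {A B C D : Env (suc (suc n))} {T₁ T₂ : Ty} →
                           IsUnion A B (ext (i T) (ext (o T) Γ)) → IsUnion C D B →
                           A zero ≡ just (i T₁) → C (suc zero) ≡ just (o T₂) → T₁ ≡ T × T₂ ≡ T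
restricted-channel-types u uCD ea eb
  with just-injective (⊆-unionˡ u zero ea)
     | just-injective (⊆-unionʳ u (suc zero) (⊆-unionˡ uCD (suc zero) eb))
... | refl | refl = refl , refl

⊢-com : {P : Proc (suc (suc (suc n)))} {Q : Proc (suc (suc n))} →
        ν T (inp a₀ P ∣ out b₀ v ∣ Q) ⇛ ν T (P [ v ] ∣ Q)
⊢-com (t-res (t-par (t-inp ea dP) (t-par (t-out eb dv) dQ disCD uCD) dis u))
  with restricted-channel-types u uCD ea eb
... | refl , refl
  with ⊢-receive dP dv (⊆-unionˡ u) (⊆-trans (⊆-unionˡ uCD) (⊆-unionʳ u)) (disjoint-⊆ʳ (⊆-unionˡ uCD) dis)
... | image s c dP' =
  t-res (⊢-par dP' dQ s (⊆-trans (⊆-unionʳ uCD) (⊆-unionʳ u))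
               (received-disjoint c dv (disjoint-⊆ʳ (⊆-unionʳ uCD) dis) disCD))

⊢-rep : {P : Proc (suc (suc (suc n)))} {Q : Proc (suc (suc n))} →
        ν T (rep a₀ P ∣ out b₀ v ∣ Q) ⇛ ν T (rep a₀ P ∣ P [ v ] ∣ Q)
⊢-rep (t-res (t-par (t-rep Γₒ oo sₒ ea dP) (t-par (t-out eb dv) dQ disCD uCD) dis u))
  with restricted-channel-types u uCD ea eb
... | refl , refl
  with ⊢-receive dP dv (⊆-trans sₒ (⊆-unionˡ u)) (⊆-trans (⊆-unionˡ uCD) (⊆-unionʳ u)) (outputOnly-disjoint oo)
... | image s c dP' =
  t-res (⊢-par (t-rep Γₒ oo sₒ ea dP) (t-par dP' dQ G⊥D (∪-isUnion s sD)) (⊆-unionˡ u) (∪-least s sD)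
               (disjoint-∪ʳ (disjoint-sym G⊥A) (disjoint-⊆ʳ (⊆-unionʳ uCD) dis)))
  where
  sD = ⊆-trans (⊆-unionʳ uCD) (⊆-unionʳ u)
  G⊥D = received-disjoint c dv (outputOnly-disjoint oo) disCD
  G⊥A = received-disjoint c dv (outputOnly-disjoint oo) (disjoint-sym (disjoint-⊆ʳ (⊆-unionˡ uCD) dis))

theoremA3 : ∀ {n : ℕ} (Γ : Env n) (P P' : Proc n) → Γ ⊢ P → P ⟶ P' → Γ ⊢ P'
theoremA3 Γ _ _ d r-com = ⊢-com d
theoremA3 Γ _ _ d r-rep = ⊢-rep d
theoremA3 Γ _ _ (t-par d₁ d₂ dis u) (r-par r) = t-par (theoremA3 _ _ _ d₁ r) d₂ dis u
theoremA3 Γ _ _ (t-res d) (r-ν r) = t-res (theoremA3 _ _ _ d r)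
theoremA3 Γ _ _ d (r-≡ e r e') = proj₁ (⊢-≡ₛ e') (theoremA3 Γ _ _ (proj₁ (⊢-≡ₛ e) d) r)
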